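{- Let $n$ be a natural number and $k$ a natural number with $2\le k\le\frac12\log_2 n$. Then every $2$-coloring of the edges of the complete graph on $n$ vertices contains at least $2^{\frac{ -3k^2+5k-4}{2}}\binom{n}{k}$ monochromatic complete subgraphs of size $k$.
   Context: A $2$-coloring of the edges of a complete graph assigns to each edge one of two colors, red or blue. A monochromatic complete subgraph of size $k$ is a set of $k$ vertices all of whose pairs are joined by edges of the same color; such subgraphs are counted as vertex sets. -}

module Defs where

open import Data.Nat using (ℕ; _+_; _*_; _∸_; _^_; _/_)
open import Data.Bool using (Bool)
open import Data.Fin using (Fin)
open import Data.Fin.Subset using (Subset; _∈_; ∣_∣)
open import Data.Product using (Σ; _×_)
open import Data.List using (List)
open import Data.List.Relation.Unary.All using (All)
open import Data.List.Relation.Unary.Unique.Propositional using (Unique)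
open import Relation.Binary.PropositionalEquality using (_≡_; _≢_)
open import Relation.Nullary using (¬_)

-- A 2-coloring of the edges of K_n: a colour (Bool: red/blue) for each
-- ordered pair, required to be symmetric; diagonal values are irrelevant.
record TwoColoring (n : ℕ) : Set where
  field
    colour    : Fin n → Fin n → Bool
    symmetric : ∀ i j → colour i j ≡ colour j i
open TwoColoring public

MonoClique : ∀ {n} → TwoColoring n → ℕ → Subset n → Set
MonoClique {n} c k S =
  ∣ S ∣ ≡ k ×
  Σ Bool (λ b → ∀ (i j : Fin n) → i ∈ S → j ∈ S → i ≢ j → colour c i j ≡ b)

-- exponent e(k) = (3k² − 5k + 4)/2  (always an even numerator, ≥ 0)
-- the bound 2^{(−3k²+5k−4)/2} · C(n,k) is rephrased as  N · 2^e ≥ C(n,k).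
expo : ℕ → ℕ
expo k = (3 * k * k + 4 ∸ 5 * k) / 2

module Submission where

open import Defs
open import Data.Bool as Bool using (Bool; true; false)
open import Data.Fin as Fin using (Fin)
open import Data.Fin.Subset using (Subset; ⁅_⁆; _∪_; ⊥; ∣_∣; inside; outside) renaming (_∈_ to _∈ₛ_; _∉_ to _∉ₛ_)
open import Data.Fin.Subset.Properties using (x∈p∪q⁺; x∈p∪q⁻; x∈⁅y⁆⇒x≡y; x∈⁅x⁆; ∣⊥∣≡0; ∪-identityˡ; ∉⊥) renaming (_∈?_ to _∈ₛ?_)
open import Data.List using (List; []; _∷_; _++_; length; filter; concatMap; map; take; foldr; replicate; allFin; deduplicate)
open import Data.List.Properties using (length-++; length-map; length-take; length-tabulate; length-filter; filter-++; filter-notAll; filter-none; filter-≐)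
open import Data.List.Membership.Propositional using (_∈_; _∉_; find)
open import Data.List.Membership.Propositional.Properties using (∈-filter⁺; ∈-filter⁻; ∈-map⁺; ∈-map⁻; ∈-allFin; ∈-deduplicate⁺; ∈-deduplicate⁻)
import Data.List.Membership.DecPropositional as DecMembership
open import Data.List.Relation.Binary.Subset.Propositional using (_⊆_)
open import Data.List.Relation.Unary.All as All using (All; []; _∷_)
import Data.List.Relation.Unary.All.Properties as All
open import Data.List.Relation.Unary.AllPairs as AllPairs using (AllPairs; []; _∷_)
import Data.List.Relation.Unary.AllPairs.Properties as AllPairs
open import Data.List.Relation.Unary.Any as Any using (Any; here; there)
open import Data.List.Relation.Unary.Unique.Propositional using (Unique)
import Data.List.Relation.Unary.Unique.Propositional.Properties as Unique
open import Data.List.Relation.Unary.Unique.DecPropositional.Properties using (deduplicate-!)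
open import Data.Nat
open import Data.Nat.Combinatorics using (_C_; nCk+nC[k+1]≡[n+1]C[k+1]; nC1≡n)
open import Data.Nat.DivMod using (m*n/n≡m; m/n*n≤m)
open import Data.Nat.ListAction using (sum)
open import Data.Nat.Properties
open import Algebra.Properties.CommutativeSemigroup *-commutativeSemigroup using (x∙yz≈y∙xz)
open import Algebra.Properties.CommutativeSemigroup +-commutativeSemigroup using () renaming (x∙yz≈y∙xz to +-exchange)
open import Data.Nat.Tactic.RingSolver using (solve-∀)
open import Data.Product using (Σ; _×_; _,_; proj₁; proj₂)
open import Data.Sum using (inj₁; inj₂)
open import Data.Vec using (_∷_; _[_]=_)
import Data.Vec.Properties as Vec
open import Function using (_∘_; _∘′_; id)
open import Level using (0ℓ)
open import Relation.Binary.Definitions using (DecidableEquality)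
open import Relation.Binary.PropositionalEquality
open import Relation.Nullary using (¬_; Dec; yes; no; does; ¬?; _×-dec_; contradiction)
open import Relation.Unary using (Pred; Decidable) renaming (_⊆_ to _⊆ᵤ_)
open import Relation.Unary.Properties using (∁?)

-- Enumerate all runs of a randomised search in the coloured K_n: delete
-- vertices one at a time until 2^(2k) remain, then 2k − 2 times pick a vertex
-- v of the current candidate set W, record the colour b in which v has at
-- least half of W as neighbours, and continue inside the first |W|/2 of those
-- b-neighbours. Every later pick is joined to v in colour b, so the last pick
-- together with k − 1 earlier picks carrying a common colour (they exist by
-- pigeonhole) is a monochromatic K_k. A fixed k-set S is the output of few
-- runs: each deletion must spare the unpicked vertices of S, and at each pick
-- either one of them is picked or the candidate set halves. Double counting
-- runs against the distinct cliques found gives runs ≤ hits · #cliques, and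
-- the arithmetic of the two counts gives C(n,k) · hits ≤ 2^e(k) · runs.

binomial : ℕ → ℕ → ℕ
binomial n       zero    = 1
binomial zero    (suc k) = 0
binomial (suc n) (suc k) = binomial n k + binomial n (suc k)

binomial≡C : ∀ n k → binomial n k ≡ n C k
binomial≡C n       zero    = refl
binomial≡C zero    (suc k) = refl
binomial≡C (suc n) (suc k) =
  trans (cong₂ _+_ (binomial≡C n k) (binomial≡C n (suc k))) (nCk+nC[k+1]≡[n+1]C[k+1] n k)

binomial-1 : ∀ n → binomial n 1 ≡ n
binomial-1 n = trans (binomial≡C n 1) (nC1≡n n)

binomial-absorb : ∀ n k → suc k * binomial (suc n) (suc k) ≡ suc n * binomial n k
binomial-absorb zero    zero    = refl
binomial-absorb zero    (suc k) = *-zeroʳ (suc (suc k))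
binomial-absorb (suc n) zero    =
  trans (+-identityʳ _) (trans (binomial-1 (suc (suc n))) (sym (*-identityʳ (suc (suc n)))))
binomial-absorb (suc n) (suc k) = begin
    suc (suc k) * (x + y)                ≡⟨ distribute k x y ⟩
    suc k * x + x + suc (suc k) * y      ≡⟨ cong₂ (λ u v → u + x + v) (binomial-absorb n k) (binomial-absorb n (suc k)) ⟩
    suc n * a + (a + b) + suc n * b      ≡⟨ collect (suc n) a b ⟩
    suc (suc n) * (a + b)                ∎
  where
  open ≡-Reasoning
  a b x y : ℕ
  a = binomial n k
  b = binomial n (suc k)
  x = binomial (suc n) (suc k)
  y = binomial (suc n) (suc (suc k))
  distribute : ∀ k x y → suc (suc k) * (x + y) ≡ suc k * x + x + suc (suc k) * y
  distribute = solve-∀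
  collect : ∀ m a b → m * a + (a + b) + m * b ≡ suc m * (a + b)
  collect = solve-∀

binomial-weighted : ∀ n k → binomial (suc n) k * suc n ≡ suc n * binomial n k + binomial (suc n) k * k
binomial-weighted n zero    = unit (suc n)
  where
  unit : ∀ m → 1 * m ≡ m * 1 + 1 * 0
  unit = solve-∀
binomial-weighted n (suc k) = begin
    (a + b) * suc n                                  ≡⟨ split a b (suc n) ⟩
    suc n * b + suc n * a                            ≡⟨ cong (suc n * b +_) (sym (binomial-absorb n k)) ⟩
    suc n * b + suc k * binomial (suc n) (suc k)     ≡⟨ cong (suc n * b +_) (*-comm (suc k) _) ⟩
    suc n * b + binomial (suc n) (suc k) * suc k     ∎
  where
  open ≡-Reasoning
  a b : ℕ
  a = binomial n k
  b = binomial n (suc k)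
  split : ∀ a b m → (a + b) * m ≡ m * b + m * a
  split = solve-∀

binomial-complement : ∀ n k → binomial (suc n) k * (suc n ∸ k) ≡ suc n * binomial n k
binomial-complement n k = begin
    c * (suc n ∸ k)                               ≡⟨ *-distribˡ-∸ c (suc n) k ⟩
    c * suc n ∸ c * k                             ≡⟨ cong (_∸ c * k) (binomial-weighted n k) ⟩
    suc n * binomial n k + c * k ∸ c * k          ≡⟨ m+n∸n≡m (suc n * binomial n k) (c * k) ⟩
    suc n * binomial n k                          ∎
  where
  open ≡-Reasoning
  c : ℕ
  c = binomial (suc n) k

binomial*!≤^ : ∀ m k → binomial m k * k ! ≤ m ^ k
binomial*!≤^ m       zero    = ≤-refl
binomial*!≤^ zero    (suc k) = z≤n
binomial*!≤^ (suc m) (suc k) = begin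
    binomial (suc m) (suc k) * (suc k * k !)   ≡⟨ sym (*-assoc (binomial (suc m) (suc k)) (suc k) (k !)) ⟩
    binomial (suc m) (suc k) * suc k * k !     ≡⟨ cong (_* k !) (trans (*-comm _ (suc k)) (binomial-absorb m k)) ⟩
    suc m * binomial m k * k !                 ≡⟨ *-assoc (suc m) (binomial m k) (k !) ⟩
    suc m * (binomial m k * k !)               ≤⟨ *-monoʳ-≤ (suc m) (binomial*!≤^ m k) ⟩
    suc m * m ^ k                              ≤⟨ *-monoʳ-≤ (suc m) (^-monoˡ-≤ k (n≤1+n m)) ⟩
    suc m * suc m ^ k                          ∎
  where open ≤-Reasoning

-- Schedules of the search and their run counts

data Step : Set where
  delete pick : Step

-- runCount ss w is the number of runs of the search on w candidates
-- following ss; hitBound ss w r bounds the number of those runs that output a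
-- fixed set S of which r vertices are still unpicked (see hits-runs≤hitBound).
runCount : List Step → ℕ → ℕ
runCount []            w = 1
runCount (delete ∷ ss) w = w * runCount ss (pred w)
runCount (pick ∷ ss)   w = w * runCount ss (w / 2)

hitBound : List Step → ℕ → ℕ → ℕ
hitBound []            w zero    = 1
hitBound []            w (suc r) = 0
hitBound (delete ∷ ss) w r       = (w ∸ r) * hitBound ss (pred w) r
hitBound (pick ∷ ss)   w r       = r * hitBound ss (w / 2) (pred r) + w * hitBound ss (w / 2) r

picks : ℕ → List Step
picks q = replicate q pick

deletes : ℕ → List Step
deletes j = replicate j delete

#picks : List Step → ℕ
#picks []            = 0
#picks (delete ∷ ss) = #picks ss
#picks (pick ∷ ss)   = suc (#picks ss)

-- The pick phase

pickHits : ℕ → ℕ → ℕ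
pickHits q = hitBound (picks q) (2 ^ (q + 2))

pickRuns : ℕ → ℕ
pickRuns q = runCount (picks q) (2 ^ (q + 2))

half-2^ : ∀ q → 2 ^ (suc q + 2) / 2 ≡ 2 ^ (q + 2)
half-2^ q = trans (cong (_/ 2) (*-comm 2 (2 ^ (q + 2)))) (m*n/n≡m (2 ^ (q + 2)) 2)

pickHits-suc : ∀ q r → pickHits (suc q) r ≡ r * pickHits q (pred r) + 2 ^ (suc q + 2) * pickHits q r
pickHits-suc q r rewrite half-2^ q = refl

pickRuns-suc : ∀ q → pickRuns (suc q) ≡ 2 ^ (suc q + 2) * pickRuns q
pickRuns-suc q rewrite half-2^ q = refl

pickHits-zero : ∀ q → pickHits q 0 ≡ pickRuns q
pickHits-zero zero    = refl
pickHits-zero (suc q) = begin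
    pickHits (suc q) 0                 ≡⟨ pickHits-suc q 0 ⟩
    2 ^ (suc q + 2) * pickHits q 0     ≡⟨ cong (2 ^ (suc q + 2) *_) (pickHits-zero q) ⟩
    2 ^ (suc q + 2) * pickRuns q       ≡⟨ sym (pickRuns-suc q) ⟩
    pickRuns (suc q)                   ∎
  where open ≡-Reasoning

pickHits-> : ∀ {q r} → q < r → pickHits q r ≡ 0
pickHits-> {zero}  {suc r} _          = refl
pickHits-> {suc q} {suc r} (s≤s q<r) = begin
    pickHits (suc q) (suc r)                                      ≡⟨ pickHits-suc q (suc r) ⟩
    suc r * pickHits q r + 2 ^ (suc q + 2) * pickHits q (suc r)   ≡⟨ cong₂ (λ u v → suc r * u + 2 ^ (suc q + 2) * v)
                                                                            (pickHits-> q<r) (pickHits-> (m<n⇒m<1+n q<r)) ⟩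
    suc r * 0 + 2 ^ (suc q + 2) * 0                               ≡⟨ cong₂ _+_ (*-zeroʳ (suc r)) (*-zeroʳ (2 ^ (suc q + 2))) ⟩
    0                                                             ∎
  where open ≡-Reasoning

pickRuns-pos : ∀ q → 0 < pickRuns q
pickRuns-pos zero    = s≤s z≤n
pickRuns-pos (suc q) = subst (0 <_) (sym (pickRuns-suc q)) (*-mono-< (m^n>0 2 (suc q + 2)) (pickRuns-pos q))

scaledHits : ℕ → ℕ → ℕ
scaledHits q r = 2 ^ ((q + 2) * r) * pickHits q r

scaledHits-suc : ∀ q r → scaledHits (suc q) (suc r) ≡
  2 ^ (suc q + 2) * (suc r * 2 ^ r * scaledHits q r + 2 ^ suc r * scaledHits q (suc r))
scaledHits-suc q r = begin
    X * pickHits (suc q) (suc r)                  ≡⟨ cong (X *_) (pickHits-suc q (suc r)) ⟩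
    X * (suc r * a + S * b)                       ≡⟨ *-distribˡ-+ X (suc r * a) (S * b) ⟩
    X * (suc r * a) + X * (S * b)                 ≡⟨ cong₂ (λ u v → u * (suc r * a) + v * (S * b)) viaR viaSucR ⟩
    A * P * S * (suc r * a) + B * (2 * P) * (S * b) ≡⟨ regroup A B P S (suc r) a b ⟩
    S * (suc r * P * (A * a) + 2 * P * (B * b))   ∎
  where
  open ≡-Reasoning
  X A B S P a b : ℕ
  X = 2 ^ ((suc q + 2) * suc r)
  A = 2 ^ ((q + 2) * r)
  B = 2 ^ ((q + 2) * suc r)
  S = 2 ^ (suc q + 2)
  P = 2 ^ r
  a = pickHits q r
  b = pickHits q (suc r)
  splitR : ∀ q r → (suc q + 2) * suc r ≡ (q + 2) * r + r + (suc q + 2)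
  splitR = solve-∀
  splitSucR : ∀ q r → (suc q + 2) * suc r ≡ (q + 2) * suc r + suc r
  splitSucR = solve-∀
  viaR : X ≡ A * P * S
  viaR = trans (cong (2 ^_) (splitR q r))
    (trans (^-distribˡ-+-* 2 ((q + 2) * r + r) (suc q + 2)) (cong (_* S) (^-distribˡ-+-* 2 ((q + 2) * r) r)))
  viaSucR : X ≡ B * (2 * P)
  viaSucR = trans (cong (2 ^_) (splitSucR q r)) (^-distribˡ-+-* 2 ((q + 2) * suc r) (suc r))
  regroup : ∀ A B P S s a b → A * P * S * (s * a) + B * (2 * P) * (S * b) ≡ S * (s * P * (A * a) + 2 * P * (B * b))
  regroup = solve-∀

β : ℕ → ℕ
β zero                = 1
β (suc zero)          = 4
β (suc (suc d))       = 2 * β (suc d) + 4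

β-suc+4 : ∀ d → β (suc d) + 4 ≡ 4 * 2 ^ suc d
β-suc+4 zero    = refl
β-suc+4 (suc d) = begin
    2 * b + 4 + 4      ≡⟨ double b ⟩
    2 * (b + 4)        ≡⟨ cong (2 *_) (β-suc+4 d) ⟩
    2 * (4 * 2 ^ suc d) ≡⟨ x∙yz≈y∙xz 2 4 (2 ^ suc d) ⟩
    4 * 2 ^ suc (suc d) ∎
  where
  open ≡-Reasoning
  b : ℕ
  b = β (suc d)
  double : ∀ b → 2 * b + 4 + 4 ≡ 2 * (b + 4)
  double = solve-∀

2^≤β : ∀ d → 2 ^ d ≤ β d
2^≤β zero          = ≤-refl
2^≤β (suc zero)    = s≤s (s≤s z≤n)
2^≤β (suc (suc d)) = ≤-trans (*-monoʳ-≤ 2 (2^≤β (suc d))) (m≤m+n (2 * β (suc d)) 4)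

β≤4*2^ : ∀ d → β d ≤ 4 * 2 ^ d
β≤4*2^ zero    = s≤s z≤n
β≤4*2^ (suc d) = subst (β (suc d) ≤_) (β-suc+4 d) (m≤m+n (β (suc d)) 4)

β-step : ∀ d → β (suc d) + 2 * β d * 2 ^ suc d ≤ β (suc d) * 2 ^ suc d
β-step zero    = ≤-refl
β-step (suc d) = begin
    (2 * b + 4) + 2 * b * x          ≤⟨ m≤m+n _ 4 ⟩
    (2 * b + 4) + 2 * b * x + 4      ≡⟨ expand b x ⟩
    2 * b * x + 2 * (b + 4)          ≡⟨ cong (λ y → 2 * b * x + 2 * y) (β-suc+4 d) ⟩
    2 * b * x + 2 * (4 * 2 ^ suc d)  ≡⟨ collect b (2 ^ suc d) ⟩
    (2 * b + 4) * x                  ∎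
  where
  open ≤-Reasoning
  b x : ℕ
  b = β (suc d)
  x = 2 ^ suc (suc d)
  expand : ∀ b x → (2 * b + 4) + 2 * b * x + 4 ≡ 2 * b * x + 2 * (b + 4)
  expand = solve-∀
  collect : ∀ b y → 2 * b * (2 * y) + 2 * (4 * y) ≡ (2 * b + 4) * (2 * y)
  collect = solve-∀

tri : ℕ → ℕ → ℕ
tri d zero    = 0
tri d (suc r) = tri d r + (r + d)

tri-suc-offset : ∀ d r → tri (suc d) r ≡ tri d r + r
tri-suc-offset d zero    = refl
tri-suc-offset d (suc r) = trans (cong (_+ (r + suc d)) (tri-suc-offset d r)) (shift r (tri d r) d)
  where
  shift : ∀ r t d → t + r + (r + suc d) ≡ t + (r + d) + suc r
  shift = solve-∀

2*tri : ∀ d r → 2 * tri d r + r ≡ r * (2 * d + r)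
2*tri d zero    = refl
2*tri d (suc r) = begin
    2 * (tri d r + (r + d)) + suc r            ≡⟨ split (tri d r) r d ⟩
    (2 * tri d r + r) + (2 * r + 2 * d + 1)    ≡⟨ cong (_+ (2 * r + 2 * d + 1)) (2*tri d r) ⟩
    r * (2 * d + r) + (2 * r + 2 * d + 1)      ≡⟨ collect r d ⟩
    suc r * (2 * d + suc r)                    ∎
  where
  open ≡-Reasoning
  split : ∀ t r d → 2 * (t + (r + d)) + suc r ≡ (2 * t + r) + (2 * r + 2 * d + 1)
  split = solve-∀
  collect : ∀ r d → r * (2 * d + r) + (2 * r + 2 * d + 1) ≡ suc r * (2 * d + suc r)
  collect = solve-∀

pow-tri-suc : ∀ d r → 2 ^ tri d (suc r) ≡ 2 ^ tri d r * 2 ^ r * 2 ^ d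
pow-tri-suc d r = trans (^-distribˡ-+-* 2 (tri d r) (r + d))
  (trans (cong (2 ^ tri d r *_) (^-distribˡ-+-* 2 r d)) (sym (*-assoc (2 ^ tri d r) (2 ^ r) (2 ^ d))))

pow-tri-suc-offset : ∀ d r → 2 ^ tri (suc d) r ≡ 2 ^ tri d r * 2 ^ r
pow-tri-suc-offset d r = trans (cong (2 ^_) (tri-suc-offset d r)) (^-distribˡ-+-* 2 (tri d r) r)

estimate : ℕ → ℕ → ℕ → ℕ
estimate q r d = r ! * β d * 2 ^ tri d r * pickRuns q

scaledHits-bound-start : ∀ q d → scaledHits q 0 * 2 ^ d ≤ estimate q 0 d
scaledHits-bound-start q d = begin
    2 ^ ((q + 2) * 0) * pickHits q 0 * 2 ^ d   ≡⟨ cong₂ (λ e h → 2 ^ e * h * 2 ^ d) (*-zeroʳ (q + 2)) (pickHits-zero q) ⟩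
    1 * pickRuns q * 2 ^ d                     ≤⟨ *-monoʳ-≤ (1 * pickRuns q) (2^≤β d) ⟩
    1 * pickRuns q * β d                       ≡⟨ reorder (pickRuns q) (β d) ⟩
    1 * β d * 1 * pickRuns q                   ∎
  where
  open ≤-Reasoning
  reorder : ∀ T b → 1 * T * b ≡ 1 * b * 1 * T
  reorder = solve-∀

scaledHits-bound-last : ∀ q r → q ≤ r → scaledHits q r * 1 ≤ estimate q r 0 →
  scaledHits (suc q) (suc r) * 1 ≤ estimate (suc q) (suc r) 0
scaledHits-bound-last q r q≤r bound = begin
    scaledHits (suc q) (suc r) * 1                          ≡⟨ cong (_* 1) (scaledHits-suc q r) ⟩
    S * (suc r * P * scaledHits q r + 2 * P * H′) * 1       ≡⟨ cong (λ h → S * (suc r * P * scaledHits q r + 2 * P * h) * 1) H′≡0 ⟩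
    S * (suc r * P * scaledHits q r + 2 * P * 0) * 1        ≡⟨ drop S (suc r * P) (2 * P) (scaledHits q r) ⟩
    S * (suc r * P) * (scaledHits q r * 1)                  ≤⟨ *-monoʳ-≤ (S * (suc r * P)) bound ⟩
    S * (suc r * P) * (r ! * 1 * t * T)                     ≡⟨ regroup S (suc r) P (r !) t T ⟩
    suc r ! * 1 * (t * P * 1) * (S * T)                     ≡⟨ cong₂ (λ u v → suc r ! * 1 * u * v) (sym (pow-tri-suc 0 r)) (sym (pickRuns-suc q)) ⟩
    suc r ! * 1 * 2 ^ tri 0 (suc r) * pickRuns (suc q)      ∎
  where
  open ≤-Reasoning
  S P t T H′ : ℕ
  S = 2 ^ (suc q + 2)
  P = 2 ^ r
  t = 2 ^ tri 0 r
  T = pickRuns q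
  H′ = scaledHits q (suc r)
  H′≡0 : H′ ≡ 0
  H′≡0 = trans (cong (2 ^ ((q + 2) * suc r) *_) (pickHits-> (s≤s q≤r))) (*-zeroʳ (2 ^ ((q + 2) * suc r)))
  drop : ∀ S u v h → S * (u * h + v * 0) * 1 ≡ S * u * (h * 1)
  drop = solve-∀
  regroup : ∀ S s P f t T → S * (s * P) * (f * 1 * t * T) ≡ s * f * 1 * (t * P * 1) * (S * T)
  regroup = solve-∀

scaledHits-bound-step : ∀ q r d →
  scaledHits q r * 2 ^ suc d ≤ estimate q r (suc d) → scaledHits q (suc r) * 2 ^ d ≤ estimate q (suc r) d →
  scaledHits (suc q) (suc r) * 2 ^ suc d ≤ estimate (suc q) (suc r) (suc d)
scaledHits-bound-step q r d bound bound′ = begin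
    scaledHits (suc q) (suc r) * 2 ^ suc d
      ≡⟨ cong (_* 2 ^ suc d) (scaledHits-suc q r) ⟩
    S * (suc r * P * scaledHits q r + 2 * P * scaledHits q (suc r)) * (2 * D)
      ≡⟨ split S (suc r * P) (2 * P) (scaledHits q r) (scaledHits q (suc r)) D ⟩
    S * (suc r * P * (scaledHits q r * 2 ^ suc d) + 2 * P * 2 * (scaledHits q (suc r) * D))
      ≤⟨ *-monoʳ-≤ S (+-mono-≤ (*-monoʳ-≤ (suc r * P) bound) (*-monoʳ-≤ (2 * P * 2) bound′)) ⟩
    S * (suc r * P * (r ! * β (suc d) * 2 ^ tri (suc d) r * T) + 2 * P * 2 * (suc r ! * β d * 2 ^ tri d (suc r) * T))
      ≡⟨ cong₂ (λ u v → S * (suc r * P * (r ! * β (suc d) * u * T) + 2 * P * 2 * (suc r ! * β d * v * T)))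
               (pow-tri-suc-offset d r) (pow-tri-suc d r) ⟩
    S * (suc r * P * (r ! * β (suc d) * (t * P) * T) + 2 * P * 2 * (suc r ! * β d * (t * P * D) * T))
      ≡⟨ factor S (suc r) (r !) P t D T (β (suc d)) (β d) ⟩
    K * (β (suc d) + 2 * β d * (2 * D))
      ≤⟨ *-monoʳ-≤ K (β-step d) ⟩
    K * (β (suc d) * (2 * D))
      ≡⟨ unfactor S (suc r) (r !) P t D T (β (suc d)) ⟩
    suc r ! * β (suc d) * (t * P * P * (2 * D)) * (S * T)
      ≡⟨ cong₂ (λ u v → suc r ! * β (suc d) * u * v) (sym target-power) (sym (pickRuns-suc q)) ⟩
    suc r ! * β (suc d) * 2 ^ tri (suc d) (suc r) * pickRuns (suc q)
      ∎
  where
  open ≤-Reasoning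
  S P D t T K : ℕ
  S = 2 ^ (suc q + 2)
  P = 2 ^ r
  D = 2 ^ d
  t = 2 ^ tri d r
  T = pickRuns q
  K = S * T * suc r ! * P * t * P
  target-power : 2 ^ tri (suc d) (suc r) ≡ t * P * P * (2 * D)
  target-power = trans (pow-tri-suc (suc d) r) (cong (λ u → u * P * (2 * D)) (pow-tri-suc-offset d r))
  split : ∀ S u v a b D → S * (u * a + v * b) * (2 * D) ≡ S * (u * (a * (2 * D)) + v * 2 * (b * D))
  split = solve-∀
  factor : ∀ S s f P t D T B b →
    S * (s * P * (f * B * (t * P) * T) + 2 * P * 2 * (s * f * b * (t * P * D) * T)) ≡
    S * T * (s * f) * P * t * P * (B + 2 * b * (2 * D))
  factor = solve-∀
  unfactor : ∀ S s f P t D T B → S * T * (s * f) * P * t * P * (B * (2 * D)) ≡ s * f * B * (t * P * P * (2 * D)) * (S * T)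
  unfactor = solve-∀

-- Writing Z d r for scaledHits (r + d) r divided by r ! * 2 ^ tri d r *
-- pickRuns (r + d), scaledHits-suc becomes Z (d+1) (r+1) = Z (d+1) r / 2^(d+1)
-- + Z d (r+1), and β-step is what keeps Z d r ≤ β d / 2 ^ d.
scaledHits-bound : ∀ q r d → r + d ≡ q → scaledHits q r * 2 ^ d ≤ estimate q r d
scaledHits-bound q                  zero    d       refl = scaledHits-bound-start q d
scaledHits-bound (suc .(r + 0))     (suc r) zero    refl =
  scaledHits-bound-last (r + 0) r (≤-reflexive (+-identityʳ r)) (scaledHits-bound (r + 0) r 0 refl)
scaledHits-bound (suc .(r + suc d)) (suc r) (suc d) refl =
  scaledHits-bound-step (r + suc d) r d (scaledHits-bound _ r (suc d) refl) (scaledHits-bound _ (suc r) d (sym (+-suc r d)))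

expo≡2+tri : ∀ d → expo (suc (suc d)) ≡ 2 + tri d (suc (suc d))
expo≡2+tri d = begin
    (3 * k * k + 4 ∸ 5 * k) / 2           ≡⟨ cong (λ x → (x ∸ 5 * k) / 2) numerator ⟩
    (2 * (2 + t) + 5 * k ∸ 5 * k) / 2     ≡⟨ cong (_/ 2) (m+n∸n≡m (2 * (2 + t)) (5 * k)) ⟩
    (2 * (2 + t)) / 2                     ≡⟨ cong (_/ 2) (*-comm 2 (2 + t)) ⟩
    ((2 + t) * 2) / 2                     ≡⟨ m*n/n≡m (2 + t) 2 ⟩
    2 + t                                 ∎
  where
  open ≡-Reasoning
  k t : ℕ
  k = suc (suc d)
  t = tri d k
  expand : ∀ d t → 2 * (2 + t) + 5 * suc (suc d) ≡ 4 + (2 * t + suc (suc d)) + 4 * suc (suc d)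
  expand = solve-∀
  collect : ∀ d → 4 + suc (suc d) * (2 * d + suc (suc d)) + 4 * suc (suc d) ≡ 3 * suc (suc d) * suc (suc d) + 4
  collect = solve-∀
  numerator : 3 * k * k + 4 ≡ 2 * (2 + t) + 5 * k
  numerator = sym (trans (expand d t) (trans (cong (λ x → 4 + x + 4 * k) (2*tri d k)) (collect d)))

pickPhase-bound : ∀ d → let k = suc (suc d) in
  binomial (2 ^ (k + d + 2)) k * pickHits (k + d) k ≤ 2 ^ expo k * pickRuns (k + d)
pickPhase-bound d = subst (λ e → c * h ≤ 2 ^ e * T) (sym (expo≡2+tri d))
    (*-cancelʳ-≤ (c * h) (2 ^ (2 + t) * T) (k ! * 2 ^ d) {{k!*2^d≢0}} scaled)
  where
  open ≤-Reasoning
  k q m c h T t : ℕ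
  k = suc (suc d)
  q = k + d
  m = 2 ^ (q + 2)
  c = binomial m k
  h = pickHits q k
  T = pickRuns q
  t = tri d k
  k!*2^d≢0 : NonZero (k ! * 2 ^ d)
  k!*2^d≢0 = m*n≢0 (k !) (2 ^ d) {{k !≢0}} {{m^n≢0 2 d}}
  shuffle : ∀ c h f D → c * h * (f * D) ≡ c * f * (h * D)
  shuffle = solve-∀
  collect : ∀ f D t T → f * (4 * D) * t * T ≡ 2 * (2 * t) * T * (f * D)
  collect = solve-∀
  scaled : c * h * (k ! * 2 ^ d) ≤ 2 ^ (2 + t) * T * (k ! * 2 ^ d)
  scaled = begin
      c * h * (k ! * 2 ^ d)               ≡⟨ shuffle c h (k !) (2 ^ d) ⟩
      c * k ! * (h * 2 ^ d)               ≤⟨ *-monoˡ-≤ (h * 2 ^ d) (binomial*!≤^ m k) ⟩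
      m ^ k * (h * 2 ^ d)                 ≡⟨ trans (cong (_* (h * 2 ^ d)) (^-*-assoc 2 (q + 2) k)) (sym (*-assoc (2 ^ ((q + 2) * k)) h (2 ^ d))) ⟩
      scaledHits q k * 2 ^ d              ≤⟨ scaledHits-bound q k d refl ⟩
      k ! * β d * 2 ^ t * T               ≤⟨ *-monoˡ-≤ T (*-monoˡ-≤ (2 ^ t) (*-monoʳ-≤ (k !) (β≤4*2^ d))) ⟩
      k ! * (4 * 2 ^ d) * 2 ^ t * T       ≡⟨ collect (k !) (2 ^ d) (2 ^ t) T ⟩
      2 ^ (2 + t) * T * (k ! * 2 ^ d)     ∎

-- The deletion phase

deletion-preserves-ratio : ∀ k E {N} ss → binomial N k * hitBound ss N k ≤ E * runCount ss N →
  binomial (suc N) k * hitBound (delete ∷ ss) (suc N) k ≤ E * runCount (delete ∷ ss) (suc N)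
deletion-preserves-ratio k E {N} ss ratio = begin
    binomial (suc N) k * ((suc N ∸ k) * h)   ≡⟨ sym (*-assoc (binomial (suc N) k) (suc N ∸ k) h) ⟩
    binomial (suc N) k * (suc N ∸ k) * h     ≡⟨ cong (_* h) (binomial-complement N k) ⟩
    suc N * binomial N k * h                 ≡⟨ *-assoc (suc N) (binomial N k) h ⟩
    suc N * (binomial N k * h)               ≤⟨ *-monoʳ-≤ (suc N) ratio ⟩
    suc N * (E * runCount ss N)              ≡⟨ x∙yz≈y∙xz (suc N) E (runCount ss N) ⟩
    E * (suc N * runCount ss N)              ∎
  where
  open ≤-Reasoning
  h : ℕ
  h = hitBound ss N k

deletions-preserve-ratio : ∀ k E {m} ss j → binomial m k * hitBound ss m k ≤ E * runCount ss m →
  binomial (j + m) k * hitBound (deletes j ++ ss) (j + m) k ≤ E * runCount (deletes j ++ ss) (j + m)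
deletions-preserve-ratio k E ss zero    ratio = ratio
deletions-preserve-ratio k E ss (suc j) ratio =
  deletion-preserves-ratio k E (deletes j ++ ss) (deletions-preserve-ratio k E ss j ratio)

runCount≤runCount-deletes : ∀ ss m j → runCount ss m ≤ runCount (deletes j ++ ss) (j + m)
runCount≤runCount-deletes ss m zero    = ≤-refl
runCount≤runCount-deletes ss m (suc j) = ≤-trans (runCount≤runCount-deletes ss m j) (m≤m+n _ _)

schedule : ℕ → ℕ → List Step
schedule n d = deletes (n ∸ 2 ^ (suc (suc d) + d + 2)) ++ picks (suc (suc d) + d)

#picks-schedule : ∀ n d → #picks (schedule n d) ≡ suc (suc d) + d
#picks-schedule n d = #picks-deletes++picks (n ∸ 2 ^ (suc (suc d) + d + 2)) (suc (suc d) + d)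
  where
  #picks-deletes++picks : ∀ j q → #picks (deletes j ++ picks q) ≡ q
  #picks-deletes++picks (suc j) q       = #picks-deletes++picks j q
  #picks-deletes++picks zero    zero    = refl
  #picks-deletes++picks zero    (suc q) = cong suc (#picks-deletes++picks zero q)

module _ {n : ℕ} (d : ℕ) (4^k≤n : 2 ^ (2 * suc (suc d)) ≤ n) where

  private
    k q m j : ℕ
    k = suc (suc d)
    q = k + d
    m = 2 ^ (q + 2)
    j = n ∸ m
    j+m≡n : j + m ≡ n
    j+m≡n = m∸n+n≡m (subst (λ e → 2 ^ e ≤ n) (2k≡q+2 d) 4^k≤n)
      where
      2k≡q+2 : ∀ d → 2 * suc (suc d) ≡ suc (suc d) + d + 2
      2k≡q+2 = solve-∀

  schedule-ratio : binomial n k * hitBound (schedule n d) n k ≤ 2 ^ expo k * runCount (schedule n d) n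
  schedule-ratio = subst (λ N → binomial N k * hitBound (schedule n d) N k ≤ 2 ^ expo k * runCount (schedule n d) N) j+m≡n
    (deletions-preserve-ratio k (2 ^ expo k) (picks q) j (pickPhase-bound d))

  schedule-runs-pos : 0 < runCount (schedule n d) n
  schedule-runs-pos = subst (λ N → 0 < runCount (schedule n d) N) j+m≡n
    (≤-trans (pickRuns-pos q) (runCount≤runCount-deletes (picks q) m j))

private variable
  A B : Set

module _ {P : Pred A 0ℓ} (P? : Decidable P) where

  length-filter+∁ : ∀ xs → length (filter P? xs) + length (filter (∁? P?) xs) ≡ length xs
  length-filter+∁ []       = refl
  length-filter+∁ (x ∷ xs) with P? x
  ... | yes _ = cong suc (length-filter+∁ xs)
  ... | no  _ = trans (+-suc _ _) (cong suc (length-filter+∁ xs))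

  length-filter-filter≤ : ∀ {Q : Pred A 0ℓ} (Q? : Decidable Q) xs →
    length (filter Q? (filter P? xs)) ≤ length (filter Q? xs)
  length-filter-filter≤ Q? []       = z≤n
  length-filter-filter≤ Q? (x ∷ xs) with P? x
  ... | yes _ with Q? x
  ...   | yes _ = s≤s (length-filter-filter≤ Q? xs)
  ...   | no  _ = length-filter-filter≤ Q? xs
  length-filter-filter≤ Q? (x ∷ xs) | no _ with Q? x
  ...   | yes _ = m≤n⇒m≤1+n (length-filter-filter≤ Q? xs)
  ...   | no  _ = length-filter-filter≤ Q? xs

  sum-map-split : ∀ (g : A → ℕ) X Y xs → (∀ {x} → x ∈ xs → P x → g x ≤ X) → (∀ {x} → x ∈ xs → ¬ P x → g x ≤ Y) →
    sum (map g xs) ≤ length (filter P? xs) * X + length (filter (∁? P?) xs) * Y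
  sum-map-split g X Y []       _  _  = z≤n
  sum-map-split g X Y (x ∷ xs) gP g∁ with P? x
  ... | yes px = subst (g x + sum (map g xs) ≤_) (sym (+-assoc X (length (filter P? xs) * X) (length (filter (∁? P?) xs) * Y)))
                   (+-mono-≤ (gP (here refl) px) (sum-map-split g X Y xs (gP ∘ there) (g∁ ∘ there)))
  ... | no ¬px = subst (g x + sum (map g xs) ≤_) (+-exchange Y (length (filter P? xs) * X) (length (filter (∁? P?) xs) * Y))
                   (+-mono-≤ (g∁ (here refl) ¬px) (sum-map-split g X Y xs (gP ∘ there) (g∁ ∘ there)))

sum-map-const : ∀ (g : A → ℕ) t xs → (∀ {x} → x ∈ xs → g x ≡ t) → sum (map g xs) ≡ length xs * t
sum-map-const g t []       _ = refl
sum-map-const g t (x ∷ xs) h = cong₂ _+_ (h (here refl)) (sum-map-const g t xs (h ∘ there))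

sum-map-zero : ∀ (g : A → ℕ) xs → (∀ {x} → x ∈ xs → g x ≡ 0) → sum (map g xs) ≡ 0
sum-map-zero g xs h = trans (sum-map-const g 0 xs h) (*-zeroʳ (length xs))

length-concatMap : ∀ (f : A → List B) xs → length (concatMap f xs) ≡ sum (map (length ∘ f) xs)
length-concatMap f []       = refl
length-concatMap f (x ∷ xs) = trans (length-++ (f x)) (cong (length (f x) +_) (length-concatMap f xs))

length-filter-concatMap : ∀ {P : Pred B 0ℓ} (P? : Decidable P) (f : A → List B) xs →
  length (filter P? (concatMap f xs)) ≡ sum (map (length ∘ filter P? ∘ f) xs)
length-filter-concatMap P? f []       = refl
length-filter-concatMap P? f (x ∷ xs) = begin
    length (filter P? (f x ++ concatMap f xs))                       ≡⟨ cong length (filter-++ P? (f x) (concatMap f xs)) ⟩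
    length (filter P? (f x) ++ filter P? (concatMap f xs))           ≡⟨ length-++ (filter P? (f x)) ⟩
    length (filter P? (f x)) + length (filter P? (concatMap f xs))   ≡⟨ cong (length (filter P? (f x)) +_) (length-filter-concatMap P? f xs) ⟩
    length (filter P? (f x)) + sum (map (length ∘ filter P? ∘ f) xs) ∎
  where open ≡-Reasoning

All-concatMap⁺ : ∀ {P : Pred B 0ℓ} (f : A → List B) xs → (∀ {x} → x ∈ xs → All P (f x)) → All P (concatMap f xs)
All-concatMap⁺ f xs h = All.concat⁺ (All.map⁺ (All.tabulate h))

module WithDecEq {A : Set} (_≟_ : DecidableEquality A) where

  remove : A → List A → List A
  remove v = filter (∁? (_≟ v))

  ∈-remove⁻ : ∀ {x v} xs → x ∈ remove v xs → x ∈ xs × x ≢ v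
  ∈-remove⁻ xs = ∈-filter⁻ (∁? (_≟ _)) {xs = xs}

  ∈-remove⁺ : ∀ {x v xs} → x ∈ xs → x ≢ v → x ∈ remove v xs
  ∈-remove⁺ = ∈-filter⁺ (∁? (_≟ _))

  unique⊆⇒length≤ : ∀ {xs ys : List A} → Unique xs → xs ⊆ ys → length xs ≤ length ys
  unique⊆⇒length≤ {[]}     _             _   = z≤n
  unique⊆⇒length≤ {x ∷ xs} {ys} (x∉xs ∷ u) xs⊆ys =
    ≤-trans (s≤s (unique⊆⇒length≤ u xs⊆ys-x)) (filter-notAll (∁? (_≟ x)) ys (Any.map (λ x≡y y≢x → y≢x (sym x≡y)) (xs⊆ys (here refl))))
    where
    xs⊆ys-x : xs ⊆ remove x ys
    xs⊆ys-x y∈xs = ∈-remove⁺ (xs⊆ys (there y∈xs)) (λ y≡x → All.lookup x∉xs y∈xs (sym y≡x))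

  unique-⊆-⊇⇒length≡ : ∀ {xs ys : List A} → Unique xs → Unique ys → xs ⊆ ys → ys ⊆ xs → length xs ≡ length ys
  unique-⊆-⊇⇒length≡ uxs uys xs⊆ys ys⊆xs = ≤-antisym (unique⊆⇒length≤ uxs xs⊆ys) (unique⊆⇒length≤ uys ys⊆xs)

  length-remove : ∀ {v xs} → Unique xs → v ∈ xs → suc (length (remove v xs)) ≡ length xs
  length-remove {v} {xs} u v∈xs = unique-⊆-⊇⇒length≡ (All.map ≢-sym (All.all-filter (∁? (_≟ v)) xs) ∷ Unique.filter⁺ _ u) u v∷xs-v⊆xs xs⊆v∷xs-v
    where
    v∷xs-v⊆xs : v ∷ remove v xs ⊆ xs
    v∷xs-v⊆xs (here refl) = v∈xs
    v∷xs-v⊆xs (there y∈)  = proj₁ (∈-remove⁻ xs y∈)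
    xs⊆v∷xs-v : xs ⊆ v ∷ remove v xs
    xs⊆v∷xs-v {y} y∈xs with y ≟ v
    ... | yes refl = here refl
    ... | no  y≢v  = there (∈-remove⁺ y∈xs y≢v)

  fibres-bound : ∀ {B : Set} (f : B → A) g (L : List A) (os : List B) → Unique L → (∀ {o} → o ∈ os → f o ∈ L) →
    (∀ y → length (filter (λ o → f o ≟ y) os) ≤ g) → length os ≤ g * length L
  fibres-bound f g []      []       _          _      _     = z≤n
  fibres-bound f g []      (o ∷ os) _          f∈L    _     with () ← f∈L (here refl)
  fibres-bound f g (y ∷ L) os       (_ ∷ uL)   f∈y∷L  fibre = begin
      length os                                          ≡⟨ sym (length-filter+∁ y? os) ⟩
      length (filter y? os) + length (filter (∁? y?) os) ≤⟨ +-mono-≤ (fibre y) rest ⟩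
      g + g * length L                                   ≡⟨ sym (*-suc g (length L)) ⟩
      g * length (y ∷ L)                                 ∎
    where
    open ≤-Reasoning
    y? : Decidable (λ o → f o ≡ y)
    y? o = f o ≟ y
    f∈L : ∀ {o} → o ∈ filter (∁? y?) os → f o ∈ L
    f∈L o∈ with ∈-filter⁻ (∁? y?) o∈
    ... | o∈os , fo≢y with f∈y∷L o∈os
    ...   | here fo≡y  = contradiction fo≡y fo≢y
    ...   | there fo∈L = fo∈L
    rest : length (filter (∁? y?) os) ≤ g * length L
    rest = fibres-bound f g L (filter (∁? y?) os) uL f∈L
      (λ z → ≤-trans (length-filter-filter≤ (∁? y?) (λ o → f o ≟ z) os) (fibre z))

∈-take⁻ : ∀ m {x : A} xs → x ∈ take m xs → x ∈ xs
∈-take⁻ (suc m) (y ∷ xs) (here x≡y)  = here x≡y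
∈-take⁻ (suc m) (y ∷ xs) (there x∈) = there (∈-take⁻ m xs x∈)

length-take≡ : ∀ m (xs : List A) → m ≤ length xs → length (take m xs) ≡ m
length-take≡ m xs m≤ = trans (length-take m xs) (m≤n⇒m⊓n≡m m≤)

length-fibres : ∀ (f : A → Bool) xs →
  length (filter (λ x → f x Bool.≟ true) xs) + length (filter (λ x → f x Bool.≟ false) xs) ≡ length xs
length-fibres f []       = refl
length-fibres f (x ∷ xs) with f x
... | true  = cong suc (length-fibres f xs)
... | false = trans (+-suc _ _) (cong suc (length-fibres f xs))

AllPairs-strengthen : ∀ {R R′ : A → A → Set} {P : Pred A 0ℓ} → (∀ {x y} → R x y → P y → R′ x y) →
  ∀ {xs} → AllPairs R xs → All P xs → AllPairs R′ xs
AllPairs-strengthen f []         []         = []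
AllPairs-strengthen f (Rx ∷ Rxs) (_ ∷ Pxs)  = All.zipWith (λ (r , p) → f r p) (Rx , Pxs) ∷ AllPairs-strengthen f Rxs Pxs

toSubset : ∀ {n} → List (Fin n) → Subset n
toSubset = foldr (λ x p → ⁅ x ⁆ ∪ p) ⊥

∈-toSubset⁺ : ∀ {n} {x : Fin n} {o} → x ∈ o → x ∈ₛ toSubset o
∈-toSubset⁺ (here refl) = x∈p∪q⁺ (inj₁ (x∈⁅x⁆ _))
∈-toSubset⁺ (there x∈o) = x∈p∪q⁺ (inj₂ (∈-toSubset⁺ x∈o))

∈-toSubset⁻ : ∀ {n} {x : Fin n} o → x ∈ₛ toSubset o → x ∈ o
∈-toSubset⁻ []      x∈⊥ = contradiction x∈⊥ ∉⊥
∈-toSubset⁻ (y ∷ o) x∈ with x∈p∪q⁻ ⁅ y ⁆ (toSubset o) x∈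
... | inj₁ x∈⁅y⁆ = here (x∈⁅y⁆⇒x≡y y x∈⁅y⁆)
... | inj₂ x∈o   = there (∈-toSubset⁻ o x∈o)

∣⁅x⁆∪p∣ : ∀ {n} (x : Fin n) (p : Subset n) → x ∉ₛ p → ∣ ⁅ x ⁆ ∪ p ∣ ≡ suc ∣ p ∣
∣⁅x⁆∪p∣ Fin.zero    (outside ∷ p) _   = cong suc (cong ∣_∣ (∪-identityˡ p))
∣⁅x⁆∪p∣ Fin.zero    (inside  ∷ p) x∉p = contradiction _[_]=_.here x∉p
∣⁅x⁆∪p∣ (Fin.suc x) (outside ∷ p) x∉p = ∣⁅x⁆∪p∣ x p (x∉p ∘′ _[_]=_.there)
∣⁅x⁆∪p∣ (Fin.suc x) (inside  ∷ p) x∉p = cong suc (∣⁅x⁆∪p∣ x p (x∉p ∘′ _[_]=_.there))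

∣toSubset∣ : ∀ {n} {o : List (Fin n)} → Unique o → ∣ toSubset o ∣ ≡ length o
∣toSubset∣ {n} {[]}    []        = ∣⊥∣≡0 n
∣toSubset∣ {o = x ∷ o} (x∉o ∷ u) =
  trans (∣⁅x⁆∪p∣ x (toSubset o) (λ x∈ → All.lookup x∉o (∈-toSubset⁻ o x∈) refl)) (cong suc (∣toSubset∣ u))

-- The search

half≤larger : ∀ {x y w} → y ≤ x → suc (x + y) ≡ w → w / 2 ≤ x
half≤larger {x} {y} {w} y≤x 1+x+y≡w = s≤s⁻¹ (*-cancelʳ-< 2 (w / 2) (suc x) (begin-strict
    w / 2 * 2          ≤⟨ m/n*n≤m w 2 ⟩
    w                  ≡⟨ sym 1+x+y≡w ⟩
    suc (x + y)        ≤⟨ s≤s (+-monoʳ-≤ x y≤x) ⟩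
    suc (x + x)        <⟨ n<1+n (suc (x + x)) ⟩
    suc (suc (x + x))  ≡⟨ double x ⟩
    suc x * 2          ∎))
  where
  open ≤-Reasoning
  double : ∀ x → suc (suc (x + x)) ≡ suc x * 2
  double = solve-∀

module CliqueSearch {n : ℕ} (c : TwoColoring n) (ℓ : ℕ) where

  open WithDecEq (Fin._≟_ {n})
  open DecMembership (Fin._≟_ {n}) using (_∈?_)

  History : Set
  History = List (Fin n × Bool)

  picked : History → List (Fin n)
  picked = map proj₁

  neighbours : Fin n → Bool → List (Fin n) → List (Fin n)
  neighbours v b W = filter (λ x → colour c v x Bool.≟ b) (remove v W)

  majority : Fin n → List (Fin n) → Bool
  majority v W = does (length (neighbours v false W) ≤? length (neighbours v true W))

  next : ℕ → Fin n → List (Fin n) → List (Fin n)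
  next w v W = take (w / 2) (neighbours v (majority v W) W)

  labelled : Bool → History → History
  labelled b = filter (λ p → proj₂ p Bool.≟ b)

  commonLabel : History → Bool
  commonLabel h = does (ℓ ≤? length (labelled true h))

  output : History → List (Fin n)
  output []            = []
  output ((f , _) ∷ h) = f ∷ take ℓ (picked (labelled (commonLabel h) h))

  -- One output per run: every choice is enumerated instead of sampled.
  runs : List Step → ℕ → History → List (Fin n) → List (List (Fin n))
  runs []            w h W = output h ∷ []
  runs (delete ∷ ss) w h W = concatMap (λ v → runs ss (pred w) h (remove v W)) W
  runs (pick ∷ ss)   w h W = concatMap (λ v → runs ss (w / 2) ((v , majority v W) ∷ h) (next w v W)) W

  ∈-neighbours⁻ : ∀ {x v b} W → x ∈ neighbours v b W → x ∈ W × x ≢ v × colour c v x ≡ b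
  ∈-neighbours⁻ W x∈ with ∈-filter⁻ (λ x → colour c _ x Bool.≟ _) x∈
  ... | x∈W-v , col≡b with ∈-remove⁻ W x∈W-v
  ...   | x∈W , x≢v = x∈W , x≢v , col≡b

  ∈-next⁻ : ∀ {x} w v W → x ∈ next w v W → x ∈ W × x ≢ v × colour c v x ≡ majority v W
  ∈-next⁻ w v W x∈ = ∈-neighbours⁻ W (∈-take⁻ (w / 2) _ x∈)

  next-unique : ∀ w v {W} → Unique W → Unique (next w v W)
  next-unique w v u = Unique.take⁺ (w / 2) (Unique.filter⁺ _ (Unique.filter⁺ _ u))

  half≤length-majority : ∀ {v w W} → Unique W → v ∈ W → length W ≡ w → w / 2 ≤ length (neighbours v (majority v W) W)
  half≤length-majority {v} {w} {W} u v∈W |W|≡w = by-cases (length (neighbours v false W) ≤? length (neighbours v true W))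
    where
    split : length (neighbours v true W) + length (neighbours v false W) ≡ length (remove v W)
    split = length-fibres (colour c v) (remove v W)
    size : suc (length (remove v W)) ≡ w
    size = trans (length-remove u v∈W) |W|≡w
    by-cases : (d : Dec (length (neighbours v false W) ≤ length (neighbours v true W))) →
               w / 2 ≤ length (neighbours v (does d) W)
    by-cases (yes f≤t) = half≤larger f≤t (trans (cong suc split) size)
    by-cases (no  f≰t) = half≤larger (<⇒≤ (≰⇒> f≰t)) (trans (cong suc (trans (+-comm (length (neighbours v false W)) _) split)) size)

  length-next : ∀ {v w W} → Unique W → v ∈ W → length W ≡ w → length (next w v W) ≡ w / 2
  length-next u v∈W |W|≡w = length-take≡ _ _ (half≤length-majority u v∈W |W|≡w)

  length-runs : ∀ ss w h W → Unique W → length W ≡ w → length (runs ss w h W) ≡ runCount ss w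
  length-runs []            w h W u |W|≡w = refl
  length-runs (delete ∷ ss) w h W u |W|≡w = begin
      length (concatMap (λ v → runs ss (pred w) h (remove v W)) W)
    ≡⟨ length-concatMap _ W ⟩
      sum (map (λ v → length (runs ss (pred w) h (remove v W))) W)
    ≡⟨ sum-map-const _ (runCount ss (pred w)) W (λ v∈W →
         length-runs ss (pred w) h _ (Unique.filter⁺ _ u) (cong pred (trans (length-remove u v∈W) |W|≡w))) ⟩
      length W * runCount ss (pred w)
    ≡⟨ cong (_* runCount ss (pred w)) |W|≡w ⟩
      w * runCount ss (pred w)
    ∎
    where open ≡-Reasoning
  length-runs (pick ∷ ss)   w h W u |W|≡w = begin
      length (concatMap (λ v → runs ss (w / 2) ((v , majority v W) ∷ h) (next w v W)) W)
    ≡⟨ length-concatMap _ W ⟩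
      sum (map (λ v → length (runs ss (w / 2) ((v , majority v W) ∷ h) (next w v W))) W)
    ≡⟨ sum-map-const _ (runCount ss (w / 2)) W (λ v∈W →
         length-runs ss (w / 2) _ _ (next-unique w _ u) (length-next u v∈W |W|≡w)) ⟩
      length W * runCount ss (w / 2)
    ≡⟨ cong (_* runCount ss (w / 2)) |W|≡w ⟩
      w * runCount ss (w / 2)
    ∎
    where open ≡-Reasoning

  Agrees : History → Fin n → Set
  Agrees h x = All (λ p → colour c (proj₁ p) x ≡ proj₂ p) h

  -- The history is newest first; each pick is joined in its recorded colour to every later pick.
  Consistent : History → Set
  Consistent = AllPairs (λ p p′ → colour c (proj₁ p′) (proj₁ p) ≡ proj₂ p′)

  Good : List (Fin n) → Set
  Good o = Unique o × length o ≡ suc ℓ × Σ Bool (λ b → AllPairs (λ x y → colour c y x ≡ b) o)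

  ℓ≤length-commonLabel : ∀ h → ℓ + ℓ ≤ suc (length h) → ℓ ≤ length (labelled (commonLabel h) h)
  ℓ≤length-commonLabel h 2ℓ≤ = by-cases (ℓ ≤? t)
    where
    open ≤-Reasoning
    t f : ℕ
    t = length (labelled true h)
    f = length (labelled false h)
    by-cases : (d : Dec (ℓ ≤ t)) → ℓ ≤ length (labelled (does d) h)
    by-cases (yes ℓ≤t) = ℓ≤t
    by-cases (no  ℓ≰t) = +-cancelˡ-≤ ℓ ℓ f (begin
      ℓ + ℓ           ≤⟨ 2ℓ≤ ⟩
      suc (length h)  ≡⟨ cong suc (sym (length-fibres proj₂ h)) ⟩
      suc t + f       ≤⟨ +-monoˡ-≤ f (≰⇒> ℓ≰t) ⟩
      ℓ + f           ∎)

  output-good : ∀ h → Unique (picked h) → Consistent h → 1 ≤ ℓ → ℓ + ℓ ≤ length h → Good (output h)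
  output-good []              _             _            1≤ℓ 2ℓ≤0 with () ← ≤-trans (+-mono-≤ 1≤ℓ 1≤ℓ) 2ℓ≤0
  output-good ((f , _) ∷ h)  (f∉h ∷ uh)   (f-agrees ∷ ch) _  2ℓ≤ =
    (f∉sel ∷ unique-sel) , cong suc length-sel , b , (f-sel ∷ mono-sel)
    where
    b : Bool
    b = commonLabel h
    chosen : History
    chosen = labelled b h
    sel : List (Fin n)
    sel = take ℓ (picked chosen)
    labels : All (λ p → proj₂ p ≡ b) chosen
    labels = All.all-filter _ h
    mono-sel : AllPairs (λ x y → colour c y x ≡ b) sel
    mono-sel = AllPairs.take⁺ ℓ (AllPairs.map⁺ (AllPairs-strengthen trans (AllPairs.filter⁺ _ ch) labels))
    f-sel : All (λ y → colour c y f ≡ b) sel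
    f-sel = All.take⁺ ℓ (All.map⁺ (All.zipWith (λ (agree , label) → trans agree label) (All.filter⁺ _ f-agrees , labels)))
    unique-sel : Unique sel
    unique-sel = Unique.take⁺ ℓ (AllPairs.map⁺ (AllPairs.filter⁺ _ (AllPairs.map⁻ uh)))
    f∉sel : All (f ≢_) sel
    f∉sel = All.tabulate (λ {x} x∈sel f≡x → All.lookup f∉h (sel⊆h x∈sel) f≡x)
      where
      sel⊆h : ∀ {x} → x ∈ sel → x ∈ picked h
      sel⊆h x∈ with ∈-map⁻ proj₁ (∈-take⁻ ℓ _ x∈)
      ... | p , p∈ , refl = ∈-map⁺ proj₁ (proj₁ (∈-filter⁻ _ p∈))
    length-sel : length sel ≡ ℓ
    length-sel = length-take≡ ℓ (picked chosen)
      (subst (ℓ ≤_) (sym (length-map proj₁ chosen)) (ℓ≤length-commonLabel h 2ℓ≤))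

  runs-good : ∀ ss w h W → Unique (picked h) → Consistent h → All (Agrees h) W → All (_∉ picked h) W →
              1 ≤ ℓ → ℓ + ℓ ≤ #picks ss + length h → All Good (runs ss w h W)
  runs-good []            w h W uh ch agree fresh 1≤ℓ 2ℓ≤ = output-good h uh ch 1≤ℓ 2ℓ≤ ∷ []
  runs-good (delete ∷ ss) w h W uh ch agree fresh 1≤ℓ 2ℓ≤ = All-concatMap⁺ _ W λ {v} _ →
    runs-good ss (pred w) h (remove v W) uh ch (All.filter⁺ _ agree) (All.filter⁺ _ fresh) 1≤ℓ 2ℓ≤
  runs-good (pick ∷ ss)   w h W uh ch agree fresh 1≤ℓ 2ℓ≤ = All-concatMap⁺ _ W λ {v} v∈W →
    runs-good ss (w / 2) ((v , majority v W) ∷ h) (next w v W)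
      (All.¬Any⇒All¬ (picked h) (All.lookup fresh v∈W) ∷ uh)
      (All.lookup agree v∈W ∷ ch)
      (All.tabulate (λ x∈ → let x∈W , _ , col≡ = ∈-next⁻ w v W x∈ in col≡ ∷ All.lookup agree x∈W))
      (All.tabulate (λ x∈ → let x∈W , x≢v , _ = ∈-next⁻ w v W x∈ in ∉-cons x≢v (All.lookup fresh x∈W)))
      1≤ℓ (subst (ℓ + ℓ ≤_) (sym (+-suc (#picks ss) (length h))) 2ℓ≤)
    where
    ∉-cons : ∀ {x v : Fin n} {vs} → x ≢ v → x ∉ vs → x ∉ v ∷ vs
    ∉-cons x≢v _   (here x≡v)  = x≢v x≡v
    ∉-cons _   x∉vs (there x∈) = x∉vs x∈

  _≟ₛ_ : DecidableEquality (Subset n)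
  _≟ₛ_ = Vec.≡-dec Bool._≟_

  hits : Subset n → List (List (Fin n)) → ℕ
  hits S os = length (filter (λ o → toSubset o ≟ₛ S) os)

  Unpicked : Subset n → History → Fin n → Set
  Unpicked S h i = i ∈ₛ S × i ∉ picked h

  unpicked? : ∀ S h → Decidable (Unpicked S h)
  unpicked? S h i = (i ∈ₛ? S) ×-dec ¬? (i ∈? picked h)

  #unpicked : Subset n → History → ℕ
  #unpicked S h = length (filter (unpicked? S h) (allFin n))

  selection⊆picked : ∀ b h → take ℓ (picked (labelled b h)) ⊆ picked h
  selection⊆picked b h x∈ with ∈-map⁻ proj₁ (∈-take⁻ ℓ _ x∈)
  ... | p , p∈ , refl = ∈-map⁺ proj₁ (proj₁ (∈-filter⁻ _ p∈))

  output⊆picked : ∀ h → output h ⊆ picked h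
  output⊆picked ((f , _) ∷ h) (here x≡f) = here x≡f
  output⊆picked ((f , _) ∷ h) (there x∈) = there (selection⊆picked _ h x∈)

  no-hits : ∀ ss w h W {S i} → i ∈ₛ S → i ∉ picked h → i ∉ W → hits S (runs ss w h W) ≡ 0
  no-hits [] w h W {S} i∈S i∉h i∉W with toSubset (output h) ≟ₛ S
  ... | yes refl = contradiction (output⊆picked h (∈-toSubset⁻ (output h) i∈S)) i∉h
  ... | no  _    = refl
  no-hits (delete ∷ ss) w h W {S} i∈S i∉h i∉W =
    trans (length-filter-concatMap _ _ W) (sum-map-zero _ W λ _ →
      no-hits ss (pred w) h _ i∈S i∉h (i∉W ∘ proj₁ ∘ ∈-remove⁻ W))
  no-hits (pick ∷ ss) w h W {S} i∈S i∉h i∉W =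
    trans (length-filter-concatMap _ _ W) (sum-map-zero _ W λ v∈W →
      no-hits ss (w / 2) _ _ i∈S (λ { (here refl) → i∉W v∈W ; (there i∈h) → i∉h i∈h })
        (i∉W ∘ proj₁ ∘ ∈-next⁻ w _ W))

  private
    unique-unpicked : ∀ S h {W} → Unique W → Unique (filter (unpicked? S h) W)
    unique-unpicked S h = Unique.filter⁺ (unpicked? S h)

  #unpicked-pick : ∀ S h {v} b → Unpicked S h v → suc (#unpicked S ((v , b) ∷ h)) ≡ #unpicked S h
  #unpicked-pick S h {v} b v-unpicked = trans (cong suc same-size) (length-remove (unique-unpicked S h (Unique.allFin⁺ n)) v∈U)
    where
    U : List (Fin n)
    U = filter (unpicked? S h) (allFin n)
    v∈U : v ∈ U
    v∈U = ∈-filter⁺ (unpicked? S h) (∈-allFin v) v-unpicked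
    U′⊆U-v : filter (unpicked? S ((v , b) ∷ h)) (allFin n) ⊆ remove v U
    U′⊆U-v i∈ with ∈-filter⁻ (unpicked? S ((v , b) ∷ h)) {xs = allFin n} i∈
    ... | i∈all , i∈S , i∉v∷h = ∈-remove⁺ (∈-filter⁺ (unpicked? S h) i∈all (i∈S , i∉v∷h ∘ there)) (i∉v∷h ∘ here)
    U-v⊆U′ : remove v U ⊆ filter (unpicked? S ((v , b) ∷ h)) (allFin n)
    U-v⊆U′ {i} i∈ with ∈-remove⁻ U i∈
    ... | i∈U , i≢v with ∈-filter⁻ (unpicked? S h) {xs = allFin n} i∈U
    ...   | i∈all , i∈S , i∉h = ∈-filter⁺ (unpicked? S ((v , b) ∷ h)) i∈all
            (i∈S , λ { (here i≡v) → i≢v i≡v ; (there i∈h) → i∉h i∈h })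
    same-size : #unpicked S ((v , b) ∷ h) ≡ length (remove v U)
    same-size = unique-⊆-⊇⇒length≡ (unique-unpicked S ((v , b) ∷ h) (Unique.allFin⁺ n))
      (Unique.filter⁺ (∁? (Fin._≟ v)) (unique-unpicked S h (Unique.allFin⁺ n))) U′⊆U-v U-v⊆U′

  #unpicked-pick-other : ∀ S h {v} b → ¬ Unpicked S h v → #unpicked S ((v , b) ∷ h) ≡ #unpicked S h
  #unpicked-pick-other S h {v} b v-picked = cong length (filter-≐ (unpicked? S ((v , b) ∷ h)) (unpicked? S h) (forget , keep) (allFin n))
    where
    forget : Unpicked S ((v , b) ∷ h) ⊆ᵤ Unpicked S h
    forget (i∈S , i∉v∷h) = i∈S , i∉v∷h ∘ there
    keep : Unpicked S h ⊆ᵤ Unpicked S ((v , b) ∷ h)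
    keep (i∈S , i∉h) = i∈S , λ { (here refl) → v-picked (i∈S , i∉h) ; (there i∈h) → i∉h i∈h }

  #unpicked≤unpicked-in : ∀ S h W → (∀ {i} → Unpicked S h i → i ∈ W) → #unpicked S h ≤ length (filter (unpicked? S h) W)
  #unpicked≤unpicked-in S h W cover = unique⊆⇒length≤ (unique-unpicked S h (Unique.allFin⁺ n)) λ i∈ →
    let i-unpicked = proj₂ (∈-filter⁻ (unpicked? S h) {xs = allFin n} i∈) in ∈-filter⁺ (unpicked? S h) (cover i-unpicked) i-unpicked

  unpicked-in≤#unpicked : ∀ S h {W} → Unique W → length (filter (unpicked? S h) W) ≤ #unpicked S h
  unpicked-in≤#unpicked S h {W} u = unique⊆⇒length≤ (unique-unpicked S h u) λ {i} i∈ →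
    ∈-filter⁺ (unpicked? S h) (∈-allFin i) (proj₂ (∈-filter⁻ (unpicked? S h) {xs = W} i∈))

  hits-runs≤hitBound : ∀ ss w h W S → Unique W → All (_∉ picked h) W → length W ≡ w →
                       hits S (runs ss w h W) ≤ hitBound ss w (#unpicked S h)
  hits-runs≤hitBound [] w h W S _ _ _ with toSubset (output h) ≟ₛ S
  ... | no  _    = z≤n
  ... | yes refl = subst (λ r → 1 ≤ hitBound [] w r) (sym all-picked) ≤-refl
    where
    all-picked : #unpicked (toSubset (output h)) h ≡ 0
    all-picked = cong length (filter-none (unpicked? (toSubset (output h)) h) {xs = allFin n}
      (All.tabulate λ _ (i∈S , i∉h) → i∉h (output⊆picked h (∈-toSubset⁻ (output h) i∈S))))
  hits-runs≤hitBound (delete ∷ ss) w h W S u fresh |W|≡w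
    with Any.any? (λ i → unpicked? S h i ×-dec ¬? (i ∈? W)) (allFin n)
  ... | yes missed = let _ , _ , (i∈S , i∉h) , i∉W = find missed in
        ≤-trans (≤-reflexive (no-hits (delete ∷ ss) w h W i∈S i∉h i∉W)) z≤n
  ... | no  none = begin
      hits S (concatMap (λ v → runs ss (pred w) h (remove v W)) W)
    ≡⟨ length-filter-concatMap _ _ W ⟩
      sum (map (λ v → hits S (runs ss (pred w) h (remove v W))) W)
    ≤⟨ sum-map-split (unpicked? S h) _ 0 (hitBound ss (pred w) r) W
         (λ v∈W (v∈S , v∉h) → ≤-reflexive (no-hits ss (pred w) h _ v∈S v∉h (λ v∈W-v → proj₂ (∈-remove⁻ W v∈W-v) refl)))
         (λ v∈W _ → hits-runs≤hitBound ss (pred w) h _ S (Unique.filter⁺ _ u) (All.filter⁺ _ fresh)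
                      (cong pred (trans (length-remove u v∈W) |W|≡w))) ⟩
      length (filter (unpicked? S h) W) * 0 + length (filter (∁? (unpicked? S h)) W) * hitBound ss (pred w) r
    ≡⟨ cong (_+ length (filter (∁? (unpicked? S h)) W) * hitBound ss (pred w) r) (*-zeroʳ (length (filter (unpicked? S h) W))) ⟩
      length (filter (∁? (unpicked? S h)) W) * hitBound ss (pred w) r
    ≤⟨ *-monoˡ-≤ (hitBound ss (pred w) r) others≤ ⟩
      (w ∸ r) * hitBound ss (pred w) r
    ∎
    where
    open ≤-Reasoning
    r : ℕ
    r = #unpicked S h
    cover : ∀ {i} → Unpicked S h i → i ∈ W
    cover {i} i-unpicked with i ∈? W
    ... | yes i∈W = i∈W
    ... | no  i∉W = contradiction (Any.map (λ { refl → i-unpicked , i∉W }) (∈-allFin i)) none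
    others≤ : length (filter (∁? (unpicked? S h)) W) ≤ w ∸ r
    others≤ = begin
        length (filter (∁? (unpicked? S h)) W)
      ≡⟨ sym (m+n∸m≡n (length (filter (unpicked? S h) W)) _) ⟩
        length (filter (unpicked? S h) W) + length (filter (∁? (unpicked? S h)) W) ∸ length (filter (unpicked? S h) W)
      ≡⟨ cong (_∸ length (filter (unpicked? S h) W)) (trans (length-filter+∁ (unpicked? S h) W) |W|≡w) ⟩
        w ∸ length (filter (unpicked? S h) W)
      ≤⟨ ∸-monoʳ-≤ w (#unpicked≤unpicked-in S h W cover) ⟩
        w ∸ r
      ∎
  hits-runs≤hitBound (pick ∷ ss) w h W S u fresh |W|≡w = begin
      hits S (concatMap (λ v → runs ss (w / 2) (h′ v) (next w v W)) W)
    ≡⟨ length-filter-concatMap _ _ W ⟩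
      sum (map (λ v → hits S (runs ss (w / 2) (h′ v) (next w v W))) W)
    ≤⟨ sum-map-split (unpicked? S h) _ (hitBound ss (w / 2) (pred r)) (hitBound ss (w / 2) r) W
         (λ {v} v∈W v-unpicked → subst (λ r′ → hits S (runs ss (w / 2) (h′ v) (next w v W)) ≤ hitBound ss (w / 2) r′)
            (cong pred (#unpicked-pick S h (majority v W) v-unpicked)) (recurse v∈W))
         (λ {v} v∈W v-picked → subst (λ r′ → hits S (runs ss (w / 2) (h′ v) (next w v W)) ≤ hitBound ss (w / 2) r′)
            (#unpicked-pick-other S h (majority v W) v-picked) (recurse v∈W)) ⟩
      length (filter (unpicked? S h) W) * hitBound ss (w / 2) (pred r) + length (filter (∁? (unpicked? S h)) W) * hitBound ss (w / 2) r
    ≤⟨ +-mono-≤ (*-monoˡ-≤ (hitBound ss (w / 2) (pred r)) (unpicked-in≤#unpicked S h u))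
                (*-monoˡ-≤ (hitBound ss (w / 2) r) (≤-trans (length-filter (∁? (unpicked? S h)) W) (≤-reflexive |W|≡w))) ⟩
      r * hitBound ss (w / 2) (pred r) + w * hitBound ss (w / 2) r
    ∎
    where
    open ≤-Reasoning
    r : ℕ
    r = #unpicked S h
    h′ : Fin n → History
    h′ v = (v , majority v W) ∷ h
    recurse : ∀ {v} → v ∈ W → hits S (runs ss (w / 2) (h′ v) (next w v W)) ≤ hitBound ss (w / 2) (#unpicked S (h′ v))
    recurse {v} v∈W = hits-runs≤hitBound ss (w / 2) (h′ v) (next w v W) S (next-unique w v u)
      (All.tabulate λ x∈ → let x∈W , x≢v , _ = ∈-next⁻ w v W x∈ in
        λ { (here x≡v) → x≢v x≡v ; (there x∈h) → All.lookup fresh x∈W x∈h })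
      (length-next u v∈W |W|≡w)

  good⇒MonoClique : ∀ {o} → Good o → MonoClique c (suc ℓ) (toSubset o)
  good⇒MonoClique {o} (u , |o|≡ , b , mono) =
    trans (∣toSubset∣ u) |o|≡ , b , λ i j i∈ j∈ → coloured mono (∈-toSubset⁻ o i∈) (∈-toSubset⁻ o j∈)
    where
    coloured : ∀ {b o i j} → AllPairs (λ x y → colour c y x ≡ b) o → i ∈ o → j ∈ o → i ≢ j → colour c i j ≡ b
    coloured (_ ∷ _)    (here refl) (here refl) i≢j = contradiction refl i≢j
    coloured (xo ∷ _)   (here refl) (there j∈) _    = trans (symmetric c _ _) (All.lookup xo j∈)
    coloured (xo ∷ _)   (there i∈) (here refl) _    = All.lookup xo i∈
    coloured (_ ∷ mono) (there i∈) (there j∈) i≢j  = coloured mono i∈ j∈ i≢j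

  #unpicked-good : ∀ {o} → Good o → #unpicked (toSubset o) [] ≡ suc ℓ
  #unpicked-good {o} (u , |o|≡ , _) = trans (unique-⊆-⊇⇒length≡ (unique-unpicked _ [] (Unique.allFin⁺ n)) u ⊆o o⊆) |o|≡
    where
    ⊆o : filter (unpicked? (toSubset o) []) (allFin n) ⊆ o
    ⊆o i∈ = ∈-toSubset⁻ o (proj₁ (proj₂ (∈-filter⁻ (unpicked? (toSubset o) []) {xs = allFin n} i∈)))
    o⊆ : o ⊆ filter (unpicked? (toSubset o) []) (allFin n)
    o⊆ {i} i∈o = ∈-filter⁺ (unpicked? (toSubset o) []) (∈-allFin i) (∈-toSubset⁺ i∈o , λ ())

  outputs : List Step → List (List (Fin n))
  outputs ss = runs ss n [] (allFin n)

  cliques : List Step → List (Subset n)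
  cliques ss = deduplicate _≟ₛ_ (map toSubset (outputs ss))

  cliques-unique : ∀ ss → Unique (cliques ss)
  cliques-unique ss = deduplicate-! _≟ₛ_ (map toSubset (outputs ss))

  module _ (ss : List Step) (1≤ℓ : 1 ≤ ℓ) (enough-picks : ℓ + ℓ ≤ #picks ss) where

    outputs-good : All Good (outputs ss)
    outputs-good = runs-good ss n [] (allFin n) [] [] (All.tabulate λ _ → []) (All.tabulate λ _ ())
      1≤ℓ (subst (ℓ + ℓ ≤_) (sym (+-identityʳ (#picks ss))) enough-picks)

    cliques-mono : All (MonoClique c (suc ℓ)) (cliques ss)
    cliques-mono = All.tabulate λ S∈ →
      let o , o∈ , S≡ = ∈-map⁻ toSubset (∈-deduplicate⁻ _≟ₛ_ _ S∈)
      in subst (MonoClique c (suc ℓ)) (sym S≡) (good⇒MonoClique (All.lookup outputs-good o∈))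

    hits≤hitBound : ∀ S → hits S (outputs ss) ≤ hitBound ss n (suc ℓ)
    hits≤hitBound S with Any.any? (λ o → toSubset o ≟ₛ S) (outputs ss)
    ... | no  none = ≤-trans (≤-reflexive (cong length (filter-none _ (All.¬Any⇒All¬ _ none)))) z≤n
    ... | yes hit  = let o , o∈ , o↦S = find hit in
      subst (λ r → hits S (outputs ss) ≤ hitBound ss n r) (trans (cong (λ S → #unpicked S []) (sym o↦S)) (#unpicked-good (All.lookup outputs-good o∈)))
        (hits-runs≤hitBound ss n [] (allFin n) S (Unique.allFin⁺ n) (All.tabulate λ _ ()) (length-tabulate id))

    runCount≤hitBound*cliques : runCount ss n ≤ hitBound ss n (suc ℓ) * length (cliques ss)
    runCount≤hitBound*cliques = subst (_≤ hitBound ss n (suc ℓ) * length (cliques ss))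
      (length-runs ss n [] (allFin n) (Unique.allFin⁺ n) (length-tabulate id))
      (WithDecEq.fibres-bound _≟ₛ_ toSubset _ (cliques ss) (outputs ss) (cliques-unique ss)
        (λ o∈ → ∈-deduplicate⁺ _≟ₛ_ (∈-map⁺ toSubset o∈)) hits≤hitBound)

bound-from-ratio : ∀ {a g E T L} → a * g ≤ E * T → T ≤ g * L → 0 < T → a ≤ L * E
bound-from-ratio {g = zero}              _     T≤0  0<T = contradiction (≤-trans 0<T T≤0) λ ()
bound-from-ratio {a} {suc g} {E} {T} {L} ratio T≤gL _   = *-cancelʳ-≤ a (L * E) (suc g) (begin
    a * suc g        ≤⟨ ratio ⟩
    E * T            ≤⟨ *-monoʳ-≤ E T≤gL ⟩
    E * (suc g * L)  ≡⟨ rotate E (suc g) L ⟩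
    L * E * suc g    ∎)
  where
  open ≤-Reasoning
  rotate : ∀ a b c → a * (b * c) ≡ c * a * b
  rotate = solve-∀

mainTheorem14 : (n k : ℕ) → 2 ≤ k → 2 ^ (2 * k) ≤ n →
    (c : TwoColoring n) →
    Σ (List (Subset n)) (λ L → Unique L × All (MonoClique c k) L ×
    n C k ≤ length L * 2 ^ expo k)
mainTheorem14 n (suc zero)    (s≤s ())
mainTheorem14 n (suc (suc d)) _ 4^k≤n c =
  cliques ss , cliques-unique ss , cliques-mono ss 1≤ℓ enough-picks ,
  subst (_≤ length (cliques ss) * 2 ^ expo k) (binomial≡C n k)
    (bound-from-ratio (schedule-ratio d 4^k≤n) (runCount≤hitBound*cliques ss 1≤ℓ enough-picks) (schedule-runs-pos d 4^k≤n))
  where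
  open CliqueSearch c (suc d)
  k : ℕ
  k = suc (suc d)
  ss : List Step
  ss = schedule n d
  1≤ℓ : 1 ≤ suc d
  1≤ℓ = s≤s z≤n
  enough-picks : suc d + suc d ≤ #picks ss
  enough-picks = ≤-reflexive (trans (+-suc (suc d) d) (sym (#picks-schedule n d)))
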